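{- Define a function $\mathscr{P}(s,t)$, for integers $s\ge 0$ and $t\ge 1$, recursively by $$\mathscr{P}(0,t)=1,\qquad \mathscr{P}(s,t)=\sum_{i=1}^{\lceil t/s\rceil}\mathscr{P}\bigl(s-1,\,t-s(i-1)\bigr)\quad (s\ge 1).$$ Then for every natural number $n\ge 1$, $$p(n)=\sum_{i=0}^{\lfloor n/2\rfloor}\mathscr{P}(i,\,n+1-2i),$$ where $p(n)$ is the number of partitions of $n$.
   Context: A partition of a natural number $n$ is a way of writing $n$ as a sum of positive integers, disregarding the order of the summands; $p(n)$ denotes the number of partitions of $n$. $\lceil\cdot\rceil$ and $\lfloor\cdot\rfloor$ denote the ceiling and floor functions. -}

module Defs where

open import Data.Nat using (ℕ; zero; suc; _+_; _*_; _∸_; _≤_; _<_; _≥_)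
open import Data.Nat.DivMod using (_/_)
open import Data.List using (List; []; _∷_)
open import Data.Nat.ListAction using (sum)
open import Data.List.Relation.Unary.All using (All)
open import Data.List.Relation.Unary.Linked using (Linked)
open import Data.Product using (Σ; _×_)
open import Relation.Binary.PropositionalEquality using (_≡_)

Σ-from : ℕ → ℕ → (ℕ → ℕ) → ℕ
Σ-from a zero    f = 0
Σ-from a (suc k) f = f a + Σ-from (suc a) k f

⌈_/suc_⌉ : ℕ → ℕ → ℕ
⌈ t /suc s ⌉ = (t + s) / suc s

𝒫 : ℕ → ℕ → ℕ
𝒫 zero    t = 1
𝒫 (suc s) t = Σ-from 1 ⌈ t /suc s ⌉ (λ i → 𝒫 s (t ∸ suc s * (i ∸ 1)))

-- A partition of n: a weakly decreasing list of positive integers summing to n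
-- (order of summands disregarded by fixing the canonical non-increasing order).
Partition : ℕ → Set
Partition n = Σ (List ℕ) λ xs → All (λ x → 1 ≤ x) xs × Linked (λ a b → b ≤ a) xs × sum xs ≡ n

{-# OPTIONS --safe #-}
-- For t ≥ 1, 𝒫 s t counts the partitions, into parts of size at most s, of the
-- numbers below t: sorting them by whether the largest part equals s gives the
-- recurrence 𝒫(s,t) = 𝒫(s-1,t) + 𝒫(s,t-s), which unrolls to the defining sum.
-- A partition x ≥ y ≥ ys of n with at least two parts is determined by its second
-- part y and by ys, a partition into parts at most y of a number at most n - 2y,
-- i.e. below n + 1 - 2y; the one-part partition (n) takes the place of y = 0.
module Submission where

open import Defs
open import Data.Nat using (ℕ; zero; suc; _+_; _*_; _∸_; _/_; _≤_; _<_; _≥_; z≤n; s≤s; NonZero; _≟_; _≤?_)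
open import Data.Nat.Properties
open import Data.Nat.DivMod using (m/n≡1+[m∸n]/n; m<n⇒m/n≡0; m/n*n≤m; /-monoˡ-≤; m*n/n≡m)
open import Data.Nat.Induction using (<-rec)
open import Data.Nat.ListAction using (sum)
open import Data.Fin using (Fin)
open import Data.Fin.Properties using (+↔⊎)
open import Data.List using (List; []; _∷_)
open import Data.List.Relation.Unary.All as All using (All; []; _∷_)
open import Data.List.Relation.Unary.Linked as Linked using (Linked; []; [-]; _∷_)
open import Data.Product using (Σ; Σ-syntax; _×_; _,_; proj₁)
open import Data.Product.Function.Dependent.Propositional using (Σ-↔)
open import Data.Sum using (_⊎_; inj₁; inj₂)
open import Data.Sum.Function.Propositional using (_⊎-↔_)
open import Data.Empty using (⊥-elim)
open import Function using (_∘_)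
open import Function.Bundles using (_↔_; mk↔ₛ′)
open import Function.Properties.Inverse using (↔-refl)
open import Function.Related.Propositional using (module EquationalReasoning)
open import Relation.Nullary using (Irrelevant; yes; no)
open import Relation.Binary.PropositionalEquality

m+n<o⇒n<o∸m : ∀ m {n o} → m + n < o → n < o ∸ m
m+n<o⇒n<o∸m zero                m+n<o       = m+n<o
m+n<o⇒n<o∸m (suc m) {o = suc o} (s≤s m+n<o) = m+n<o⇒n<o∸m m m+n<o

n<o∸m⇒m+n<o : ∀ m {n o} → n < o ∸ m → m + n < o
n<o∸m⇒m+n<o zero                n<o∸m = n<o∸m
n<o∸m⇒m+n<o (suc m) {o = suc o} n<o∸m = s≤s (n<o∸m⇒m+n<o m n<o∸m)

n*m≤o⇒m≤o/n : ∀ n {m o} .{{_ : NonZero n}} → n * m ≤ o → m ≤ o / n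
n*m≤o⇒m≤o/n n {m} {o} n*m≤o = begin
  m          ≡⟨ m*n/n≡m m n ⟨
  m * n / n  ≤⟨ /-monoˡ-≤ n (≤-trans (≤-reflexive (*-comm m n)) n*m≤o) ⟩
  o / n      ∎
  where open ≤-Reasoning

m≤o/n⇒n*m≤o : ∀ n {m o} .{{_ : NonZero n}} → m ≤ o / n → n * m ≤ o
m≤o/n⇒n*m≤o n {m} {o} m≤o/n = begin
  n * m        ≤⟨ *-monoʳ-≤ n m≤o/n ⟩
  n * (o / n)  ≡⟨ *-comm n (o / n) ⟩
  o / n * n    ≤⟨ m/n*n≤m o n ⟩
  o            ∎
  where open ≤-Reasoning

⌈m∸n/1+n⌉≡m/1+n : ∀ m n → ⌈ m ∸ n /suc n ⌉ ≡ m / suc n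
⌈m∸n/1+n⌉≡m/1+n m n with n ≤? m
... | yes n≤m = cong (_/ suc n) (m∸n+n≡m n≤m)
... | no  n≰m = begin
  (m ∸ n + n) / suc n  ≡⟨ cong (λ k → (k + n) / suc n) (m≤n⇒m∸n≡0 (<⇒≤ m<n)) ⟩
  n / suc n            ≡⟨ m<n⇒m/n≡0 (n<1+n n) ⟩
  0                    ≡⟨ m<n⇒m/n≡0 (m≤n⇒m≤1+n m<n) ⟨
  m / suc n            ∎
  where
  open ≡-Reasoning
  m<n : m < n
  m<n = ≰⇒> n≰m

⌈1+m/1+n⌉≡1+⌈m∸n/1+n⌉ : ∀ m n → ⌈ suc m /suc n ⌉ ≡ suc ⌈ m ∸ n /suc n ⌉
⌈1+m/1+n⌉≡1+⌈m∸n/1+n⌉ m n = begin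
  suc (m + n) / suc n            ≡⟨ m/n≡1+[m∸n]/n (s≤s (m≤n+m n m)) ⟩
  suc ((m + n ∸ n) / suc n)      ≡⟨ cong (λ k → suc (k / suc n)) (m+n∸n≡m m n) ⟩
  suc (m / suc n)                ≡⟨ cong suc (⌈m∸n/1+n⌉≡m/1+n m n) ⟨
  suc ⌈ m ∸ n /suc n ⌉           ∎
  where open ≡-Reasoning

Σ-from-cong : ∀ a k {f g : ℕ → ℕ} → (∀ i → a ≤ i → f i ≡ g i) → Σ-from a k f ≡ Σ-from a k g
Σ-from-cong a zero    f≗g = refl
Σ-from-cong a (suc k) f≗g =
  cong₂ _+_ (f≗g a ≤-refl) (Σ-from-cong (suc a) k (λ i a<i → f≗g i (<⇒≤ a<i)))

Σ-from-suc : ∀ a k f → Σ-from (suc a) k f ≡ Σ-from a k (f ∘ suc)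
Σ-from-suc a zero    f = refl
Σ-from-suc a (suc k) f = cong (f (suc a) +_) (Σ-from-suc (suc a) k f)

𝒫-suc-zero : ∀ s → 𝒫 (suc s) 0 ≡ 0
𝒫-suc-zero s rewrite m<n⇒m/n≡0 (n<1+n s) = refl

𝒫-suc-suc : ∀ s u → 𝒫 (suc s) (suc u) ≡ 𝒫 s (suc u) + 𝒫 (suc s) (u ∸ s)
𝒫-suc-suc s u = begin
  Σ-from 1 ⌈ suc u /suc s ⌉ term         ≡⟨ cong (λ k → Σ-from 1 k term) (⌈1+m/1+n⌉≡1+⌈m∸n/1+n⌉ u s) ⟩
  term 1 + Σ-from 2 k term               ≡⟨ cong₂ _+_ (cong (λ m → 𝒫 s (suc u ∸ m)) (*-zeroʳ s)) (Σ-from-suc 1 k term) ⟩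
  𝒫 s (suc u) + Σ-from 1 k (term ∘ suc)  ≡⟨ cong (𝒫 s (suc u) +_) (Σ-from-cong 1 k shifted) ⟩
  𝒫 s (suc u) + 𝒫 (suc s) (u ∸ s)        ∎
  where
  open ≡-Reasoning
  k : ℕ
  k = ⌈ u ∸ s /suc s ⌉
  term : ℕ → ℕ
  term i = 𝒫 s (suc u ∸ suc s * (i ∸ 1))
  shifted : ∀ i → 1 ≤ i → term (suc i) ≡ 𝒫 s (u ∸ s ∸ suc s * (i ∸ 1))
  shifted (suc j) _ = cong (𝒫 s) (begin
    suc u ∸ suc s * suc j          ≡⟨ cong (suc u ∸_) (*-suc (suc s) j) ⟩
    suc u ∸ (suc s + suc s * j)    ≡⟨ ∸-+-assoc (suc u) (suc s) (suc s * j) ⟨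
    u ∸ s ∸ suc s * j              ∎)

Σ-≡-irrelevant : {A : Set} {P : A → Set} → (∀ {x} → Irrelevant (P x)) →
                 {p q : Σ A P} → proj₁ p ≡ proj₁ q → p ≡ q
Σ-≡-irrelevant irr {x , p} {.x , q} refl = cong (x ,_) (irr p q)

-- The bound s on the parts enters as a fictitious head of the non-increasing list.
IsBoundedPartition : ℕ → ℕ → List ℕ → Set
IsBoundedPartition s t xs = All (1 ≤_) xs × Linked _≥_ (s ∷ xs) × sum xs < t

BoundedPartition : ℕ → ℕ → Set
BoundedPartition s t = Σ (List ℕ) (IsBoundedPartition s t)

IsBoundedPartition-irrelevant : ∀ {s t xs} → Irrelevant (IsBoundedPartition s t xs)
IsBoundedPartition-irrelevant (ps , ls , l) (ps′ , ls′ , l′)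
  rewrite All.irrelevant ≤-irrelevant ps ps′
        | Linked.irrelevant ≤-irrelevant ls ls′
        | <-irrelevant l l′ = refl

BoundedPartition-≡ : ∀ {s t} {p q : BoundedPartition s t} → proj₁ p ≡ proj₁ q → p ≡ q
BoundedPartition-≡ = Σ-≡-irrelevant IsBoundedPartition-irrelevant

BoundedPartition[s,0]↔Fin0 : ∀ s → BoundedPartition s 0 ↔ Fin 0
BoundedPartition[s,0]↔Fin0 s = mk↔ₛ′ (λ { (_ , _ , _ , ()) }) (λ ()) (λ ()) (λ { (_ , _ , _ , ()) })

BoundedPartition[0,t]-empty : ∀ {t} (p : BoundedPartition 0 t) → [] ≡ proj₁ p
BoundedPartition[0,t]-empty ([] , _)                       = refl
BoundedPartition[0,t]-empty (_ ∷ _ , 1≤x ∷ _ , x≤0 ∷ _ , _) = ⊥-elim (<-irrefl refl (≤-trans 1≤x x≤0))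

BoundedPartition[0,1+u]↔Fin1 : ∀ u → BoundedPartition 0 (suc u) ↔ Fin 1
BoundedPartition[0,1+u]↔Fin1 u =
  mk↔ₛ′ (λ _ → Fin.zero) (λ _ → [] , [] , [-] , s≤s z≤n) (λ { Fin.zero → refl ; (Fin.suc ()) })
        (BoundedPartition-≡ ∘ BoundedPartition[0,t]-empty)

Linked-≥-weaken : ∀ {s xs} → Linked _≥_ (s ∷ xs) → Linked _≥_ (suc s ∷ xs)
Linked-≥-weaken [-]       = [-]
Linked-≥-weaken (x≤s ∷ l) = m≤n⇒m≤1+n x≤s ∷ l

BoundedPartition-split : ∀ s t →
  BoundedPartition (suc s) t ↔ (BoundedPartition s t ⊎ BoundedPartition (suc s) (t ∸ suc s))
BoundedPartition-split s t = mk↔ₛ′ split merge split∘merge merge∘split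
  where
  split : BoundedPartition (suc s) t → BoundedPartition s t ⊎ BoundedPartition (suc s) (t ∸ suc s)
  split ([] , _ , _ , l) = inj₁ ([] , [] , [-] , l)
  split (x ∷ xs , 1≤x ∷ ps , x≤1+s ∷ ls , l) with x ≟ suc s
  ... | yes refl = inj₂ (xs , ps , ls , m+n<o⇒n<o∸m (suc s) l)
  ... | no  x≢1+s = inj₁ (x ∷ xs , 1≤x ∷ ps , ≤-pred (≤∧≢⇒< x≤1+s x≢1+s) ∷ ls , l)
  merge : BoundedPartition s t ⊎ BoundedPartition (suc s) (t ∸ suc s) → BoundedPartition (suc s) t
  merge (inj₁ (xs , ps , ls , l)) = xs , ps , Linked-≥-weaken ls , l
  merge (inj₂ (xs , ps , ls , l)) = suc s ∷ xs , s≤s z≤n ∷ ps , ≤-refl ∷ ls , n<o∸m⇒m+n<o (suc s) l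
  split∘merge : ∀ p → split (merge p) ≡ p
  split∘merge (inj₁ ([] , _)) = cong inj₁ (BoundedPartition-≡ refl)
  split∘merge (inj₁ (x ∷ xs , _ ∷ _ , x≤s ∷ _ , _)) with x ≟ suc s
  ... | yes refl = ⊥-elim (<-irrefl refl x≤s)
  ... | no  _    = cong inj₁ (BoundedPartition-≡ refl)
  split∘merge (inj₂ _) with suc s ≟ suc s
  ... | yes refl = cong inj₂ (BoundedPartition-≡ refl)
  ... | no  s≢s  = ⊥-elim (s≢s refl)
  merge∘split : ∀ p → merge (split p) ≡ p
  merge∘split ([] , _) = BoundedPartition-≡ refl
  merge∘split (x ∷ xs , _ ∷ _ , _ ∷ _ , _) with x ≟ suc s
  ... | yes refl = BoundedPartition-≡ refl
  ... | no  _    = BoundedPartition-≡ refl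

-- t ≥ 1 matters only for s = 0: 𝒫 0 0 = 1, but no partition has a sum below 0.
BoundedPartition↔𝒫 : ∀ s t → 1 ≤ t → BoundedPartition s t ↔ Fin (𝒫 s t)
BoundedPartition↔𝒫 zero    (suc u) _ = BoundedPartition[0,1+u]↔Fin1 u
BoundedPartition↔𝒫 (suc s) t       _ = <-rec (λ t → BoundedPartition (suc s) t ↔ Fin (𝒫 (suc s) t)) step t
  where
  open EquationalReasoning
  step : ∀ t → (∀ {t′} → t′ < t → BoundedPartition (suc s) t′ ↔ Fin (𝒫 (suc s) t′)) →
         BoundedPartition (suc s) t ↔ Fin (𝒫 (suc s) t)
  step zero    _   = begin
    BoundedPartition (suc s) 0  ↔⟨ BoundedPartition[s,0]↔Fin0 (suc s) ⟩
    Fin 0                       ≡⟨ cong Fin (𝒫-suc-zero s) ⟨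
    Fin (𝒫 (suc s) 0)           ∎
  step (suc u) rec = begin
    BoundedPartition (suc s) (suc u)                                  ↔⟨ BoundedPartition-split s (suc u) ⟩
    (BoundedPartition s (suc u) ⊎ BoundedPartition (suc s) (u ∸ s))   ↔⟨ BoundedPartition↔𝒫 s (suc u) (s≤s z≤n) ⊎-↔ rec (s≤s (m∸n≤m u s)) ⟩
    (Fin (𝒫 s (suc u)) ⊎ Fin (𝒫 (suc s) (u ∸ s)))                     ↔⟨ +↔⊎ ⟨
    Fin (𝒫 s (suc u) + 𝒫 (suc s) (u ∸ s))                             ≡⟨ cong Fin (𝒫-suc-suc s u) ⟨
    Fin (𝒫 (suc s) (suc u))                                           ∎

Σ< : ℕ → (ℕ → Set) → Set
Σ< k A = Σ[ j ∈ ℕ ] (j < k × A j)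

Σ<-cong : ∀ k {A B : ℕ → Set} → (∀ j → j < k → A j ↔ B j) → Σ< k A ↔ Σ< k B
Σ<-cong k A↔B = Σ-↔ ↔-refl (λ {j} → Σ-↔ ↔-refl (λ {j<k} → A↔B j j<k))

Σ<-suc : ∀ k {A : ℕ → Set} → (A 0 ⊎ Σ< k (A ∘ suc)) ↔ Σ< (suc k) A
Σ<-suc k {A} = mk↔ₛ′ to from to∘from (λ { (inj₁ _) → refl ; (inj₂ _) → refl })
  where
  to : A 0 ⊎ Σ< k (A ∘ suc) → Σ< (suc k) A
  to (inj₁ a)             = 0 , s≤s z≤n , a
  to (inj₂ (j , j<k , a)) = suc j , s≤s j<k , a
  from : Σ< (suc k) A → A 0 ⊎ Σ< k (A ∘ suc)
  from (zero  , _       , a) = inj₁ a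
  from (suc j , s≤s j<k , a) = inj₂ (j , j<k , a)
  to∘from : ∀ p → to (from p) ≡ p
  to∘from (zero  , 0<1+k , a) = cong (λ 0<1+k → 0 , 0<1+k , a) (<-irrelevant _ 0<1+k)
  to∘from (suc j , s≤s _ , a) = refl

Fin-Σ-from : ∀ k (f : ℕ → ℕ) → Fin (Σ-from 0 k f) ↔ Σ< k (Fin ∘ f)
Fin-Σ-from zero    f = mk↔ₛ′ (λ ()) (λ { (_ , () , _) }) (λ { (_ , () , _) }) (λ ())
Fin-Σ-from (suc k) f = begin
  Fin (f 0 + Σ-from 1 k f)                    ↔⟨ +↔⊎ ⟩
  (Fin (f 0) ⊎ Fin (Σ-from 1 k f))            ≡⟨ cong (λ m → Fin (f 0) ⊎ Fin m) (Σ-from-suc 0 k f) ⟩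
  (Fin (f 0) ⊎ Fin (Σ-from 0 k (f ∘ suc)))    ↔⟨ ↔-refl ⊎-↔ Fin-Σ-from k (f ∘ suc) ⟩
  (Fin (f 0) ⊎ Σ< k (Fin ∘ f ∘ suc))          ↔⟨ Σ<-suc k ⟩
  Σ< (suc k) (Fin ∘ f)                        ∎
  where open EquationalReasoning

Partition-≡ : ∀ {n} {p q : Partition n} → proj₁ p ≡ proj₁ q → p ≡ q
Partition-≡ = Σ-≡-irrelevant λ where
  (ps , ls , e) (ps′ , ls′ , e′)
    → cong₂ _,_ (All.irrelevant ≤-irrelevant ps ps′)
                (cong₂ _,_ (Linked.irrelevant ≤-irrelevant ls ls′) (≡-irrelevant e e′))

m≤n⇒m<n+1 : ∀ {m n} → m ≤ n → m < n + 1
m≤n⇒m<n+1 {m} {n} m≤n = subst (m <_) (+-comm 1 n) (s≤s m≤n)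

m<n+1⇒m≤n : ∀ {m n} → m < n + 1 → m ≤ n
m<n+1⇒m≤n {m} {n} m<n+1 = ≤-pred (subst (m <_) (+-comm n 1) m<n+1)

2*m+n≡m+[m+n] : ∀ m n → 2 * m + n ≡ m + (m + n)
2*m+n≡m+[m+n] m n = trans (cong (λ k → m + k + n) (+-identityʳ m)) (+-assoc m m n)

second-part-bound : ∀ {x y S n} → y ≤ x → x + (y + S) ≡ n → 2 * y + S ≤ n
second-part-bound {x} {y} {S} {n} y≤x e = begin
  2 * y + S    ≡⟨ 2*m+n≡m+[m+n] y S ⟩
  y + (y + S)  ≤⟨ +-monoˡ-≤ (y + S) y≤x ⟩
  x + (y + S)  ≡⟨ e ⟩
  n            ∎
  where open ≤-Reasoning

largest-part-room : ∀ y S n → S < n + 1 ∸ 2 * y → y + (y + S) ≤ n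
largest-part-room y S n S<n+1∸2y = begin
  y + (y + S)  ≡⟨ 2*m+n≡m+[m+n] y S ⟨
  2 * y + S    ≤⟨ m<n+1⇒m≤n (n<o∸m⇒m+n<o (2 * y) S<n+1∸2y) ⟩
  n            ∎
  where open ≤-Reasoning

Partition↔Σ<-second-part : ∀ n → 1 ≤ n →
  Partition n ↔ Σ< (suc (n / 2)) (λ j → BoundedPartition j (n + 1 ∸ 2 * j))
Partition↔Σ<-second-part n 1≤n = mk↔ₛ′ to from to∘from from∘to
  where
  to : Partition n → Σ< (suc (n / 2)) (λ j → BoundedPartition j (n + 1 ∸ 2 * j))
  to ([] , _ , _ , 0≡n) = ⊥-elim (<-irrefl 0≡n 1≤n)
  to (_ ∷ [] , _) = 0 , s≤s z≤n , [] , [] , [-] , m≤n⇒m<n+1 z≤n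
  to (_ ∷ y ∷ ys , _ ∷ _ ∷ ps , y≤x ∷ ls , e) =
    y , s≤s (n*m≤o⇒m≤o/n 2 (≤-trans (m≤m+n (2 * y) (sum ys)) bound)) ,
    ys , ps , ls , m+n<o⇒n<o∸m (2 * y) (m≤n⇒m<n+1 bound)
    where
    bound : 2 * y + sum ys ≤ n
    bound = second-part-bound y≤x e
  from : Σ< (suc (n / 2)) (λ j → BoundedPartition j (n + 1 ∸ 2 * j)) → Partition n
  from (zero , _) = n ∷ [] , 1≤n ∷ [] , [-] , +-identityʳ n
  from (suc i , _ , ys , ps , ls , l) =
    n ∸ (suc i + sum ys) ∷ suc i ∷ ys ,
    ≤-trans (s≤s z≤n) 1+i≤x ∷ s≤s z≤n ∷ ps ,
    1+i≤x ∷ ls ,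
    m∸n+n≡m (m+n≤o⇒n≤o (suc i) room)
    where
    room : suc i + (suc i + sum ys) ≤ n
    room = largest-part-room (suc i) (sum ys) n l
    1+i≤x : suc i ≤ n ∸ (suc i + sum ys)
    1+i≤x = m+n≤o⇒m≤o∸n (suc i) room
  to∘from : ∀ p → to (from p) ≡ p
  to∘from (zero  , _ , p) =
    cong (0 ,_) (cong₂ _,_ (<-irrelevant _ _) (BoundedPartition-≡ (BoundedPartition[0,t]-empty p)))
  to∘from (suc i , _ , _) =
    cong (suc i ,_) (cong₂ _,_ (<-irrelevant _ _) (BoundedPartition-≡ refl))
  from∘to : ∀ p → from (to p) ≡ p
  from∘to ([] , _ , _ , 0≡n) = ⊥-elim (<-irrefl 0≡n 1≤n)
  from∘to (x ∷ [] , _ , _ , e) = Partition-≡ (cong (_∷ []) (trans (sym e) (+-identityʳ x)))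
  from∘to (x ∷ suc i ∷ ys , _ ∷ _ ∷ _ , _ ∷ _ , e) =
    Partition-≡ (cong (_∷ suc i ∷ ys) (trans (cong (_∸ (suc i + sum ys)) (sym e)) (m+n∸n≡m x (suc i + sum ys))))

mainTheorem1 : (n : ℕ) → 1 ≤ n →
    Partition n ↔ Fin (Σ-from 0 (suc (n / 2)) (λ i → 𝒫 i (n + 1 ∸ 2 * i)))
mainTheorem1 n 1≤n = begin
  Partition n                                                        ↔⟨ Partition↔Σ<-second-part n 1≤n ⟩
  Σ< (suc (n / 2)) (λ j → BoundedPartition j (n + 1 ∸ 2 * j))        ↔⟨ Σ<-cong (suc (n / 2)) counted ⟩
  Σ< (suc (n / 2)) (λ j → Fin (𝒫 j (n + 1 ∸ 2 * j)))                 ↔⟨ Fin-Σ-from (suc (n / 2)) _ ⟨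
  Fin (Σ-from 0 (suc (n / 2)) (λ j → 𝒫 j (n + 1 ∸ 2 * j)))           ∎
  where
  open EquationalReasoning
  counted : ∀ j → j < suc (n / 2) → BoundedPartition j (n + 1 ∸ 2 * j) ↔ Fin (𝒫 j (n + 1 ∸ 2 * j))
  counted j (s≤s j≤n/2) = BoundedPartition↔𝒫 j (n + 1 ∸ 2 * j) (m<n⇒0<n∸m (m≤n⇒m<n+1 (m≤o/n⇒n*m≤o 2 j≤n/2)))
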